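{- For all integers $1\leq r<n$, \[|K_L(r,n)|=\sum_{i=1}^{r}\binom{n-i-1}{r-i}\cdot(r)_{i-1}.\]
   Context: Let $\mathfrak{S}_n$ be the group of permutations of $\{1,\dots,n\}$ in one-line notation. A permutation $w\in\mathfrak{S}_n$ contains the split pattern $3|12$ with respect to position $r$ if there are indices $i_1\leq r<i_2<i_3$ with $w(i_2)<w(i_3)<w(i_1)$; it contains $23|1$ with respect to position $r$ if there are indices $i_1<i_2\leq r<i_3$ with $w(i_3)<w(i_1)<w(i_2)$. $K(r,n)$ is the set of $w\in\mathfrak{S}_n$ avoiding both patterns with respect to position $r$, and $K_L(r,n)$ is the set of $w\in K(r,n)$ with $n\in\{w(k):k\leq r\}$. $(m)_i=m(m-1)\cdots(m-i+1)$ is the falling factorial, with $(m)_0=1$. -}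

module Defs where

open import Data.Nat using (ℕ; zero; suc; _+_; _∸_; _<ᵇ_; _≡ᵇ_)
open import Data.Nat.Combinatorics using (_C_; _P_)
open import Data.Bool using (Bool; true; false; _∧_; _∨_; not)
open import Data.Fin using (Fin; toℕ)
open import Data.List using (List; []; _∷_; map; concatMap; length; filter; upTo; allFin)
open import Data.Bool.ListAction using (any; all)
open import Data.Nat.ListAction using (sum)
open import Relation.Nullary.Decidable using (does)
open import Data.Bool.Properties using (T?)
open import Data.Bool using (T)

-- Permutations of {1,..,n} in one-line notation are represented as
-- functions w : Fin n → Fin n (0-based values and positions).
-- Position p (0-based) corresponds to the 1-based index toℕ p + 1,
-- so "index ≤ r" becomes "toℕ p < r".

allFuns : (n m : ℕ) → List (Fin n → Fin m)
allFuns zero m = (λ ()) ∷ []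
allFuns (suc n) m =
  concatMap (λ a → map (λ f → λ { Fin.zero → a ; (Fin.suc i) → f i }) (allFuns n m)) (allFin m)

∀ᵇ : {n : ℕ} → (Fin n → Bool) → Bool
∀ᵇ {n} p = all p (allFin n)

∃ᵇ : {n : ℕ} → (Fin n → Bool) → Bool
∃ᵇ {n} p = any p (allFin n)

_<ᶠ_ : {n : ℕ} → Fin n → Fin n → Bool
i <ᶠ j = toℕ i <ᵇ toℕ j

isPerm : {n : ℕ} → (Fin n → Fin n) → Bool
isPerm w = ∀ᵇ (λ i → ∀ᵇ (λ j → not (toℕ (w i) ≡ᵇ toℕ (w j)) ∨ (toℕ i ≡ᵇ toℕ j)))

inL : {n : ℕ} → ℕ → Fin n → Bool
inL r p = toℕ p <ᵇ r

contains3|12 : {n : ℕ} → ℕ → (Fin n → Fin n) → Bool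
contains3|12 r w = ∃ᵇ λ i₁ → ∃ᵇ λ i₂ → ∃ᵇ λ i₃ →
  inL r i₁ ∧ not (inL r i₂) ∧ (i₂ <ᶠ i₃) ∧ (w i₂ <ᶠ w i₃) ∧ (w i₃ <ᶠ w i₁)

contains23|1 : {n : ℕ} → ℕ → (Fin n → Fin n) → Bool
contains23|1 r w = ∃ᵇ λ i₁ → ∃ᵇ λ i₂ → ∃ᵇ λ i₃ →
  (i₁ <ᶠ i₂) ∧ inL r i₂ ∧ not (inL r i₃) ∧ (w i₃ <ᶠ w i₁) ∧ (w i₁ <ᶠ w i₂)

inK : {n : ℕ} → ℕ → (Fin n → Fin n) → Bool
inK r w = isPerm w ∧ not (contains3|12 r w) ∧ not (contains23|1 r w)

-- n ∈ {w(k) : k ≤ r}, i.e. the maximal value (0-based n-1) occurs at a position ≤ r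
maxInLeft : {n : ℕ} → ℕ → (Fin n → Fin n) → Bool
maxInLeft {n} r w = ∃ᵇ λ k → inL r k ∧ (suc (toℕ (w k)) ≡ᵇ n)

inKL : {n : ℕ} → ℕ → (Fin n → Fin n) → Bool
inKL r w = inK r w ∧ maxInLeft r w

cardKL : ℕ → ℕ → ℕ
cardKL r n = length (filter (λ w → T? (inKL r w)) (allFuns n n))

rhs : ℕ → ℕ → ℕ
rhs r n = sum (map (λ j → ((n ∸ suc j ∸ 1) C (r ∸ suc j)) Data.Nat.* (r P j)) (upTo r))

-- Delete the entry 1 of w ∈ K_L(r+1, n+1), say at position p, and lower the other entries by one.
-- For each of the r+1 positions p ≤ r+1 this is a bijection onto K_L(r, n).  If p > r+1, the
-- entry n+1 on the left, the 1 and any later entry would form 3|12, so p = n+1; then an ascent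
-- among the first r+1 entries would form 23|1 with the final 1, and deletion is a bijection onto
-- the set K_L↓(r+1, n) of those u ∈ K_L(r+1, n) that decrease on their first r+1 positions.  In
-- an element of K_L↓(r+1, n+1) the 1 sits at position r+1 or n+1, and deletion leaves an element
-- of K_L↓(r, n) or of K_L↓(r+1, n) respectively.  So |K_L↓(r+1, n)| = C(n-1, r) by Pascal's rule,
-- and |K_L(r+1, n+1)| = (r+1) |K_L(r, n)| + C(n-1, r), a recursion the right-hand side also obeys.
module Submission where

open import Data.Bool using (Bool; true; false; T; not; _∧_; _∨_)
open import Data.Bool.Properties using (T?; T-∧)
open import Data.Empty using (⊥; ⊥-elim; ⊥-elim-irr)
open import Data.Fin using (Fin; toℕ; fromℕ; fromℕ<; punchIn; punchOut; pinch)
  renaming (zero to fzero; suc to fsuc)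
open import Data.Fin.Permutation using (↔⇒≡)
open import Data.Fin.Properties
  using ( _≟_; any?; pigeonhole; toℕ-injective; toℕ<n; toℕ-fromℕ; toℕ-fromℕ<; +↔⊎
        ; punchIn-injective; punchIn-mono-≤; punchIn-cancel-≤; punchInᵢ≢i
        ; punchIn-punchOut; punchOut-punchIn; punchOut-injective)
  renaming (suc-injective to fsuc-injective)
open import Data.Irrelevant using ([_])
open import Data.List as List
  using (List; []; _∷_; _++_; length; applyUpTo; upTo; allFin; concatMap; filterᵇ)
open import Data.List.Properties using (map-applyUpTo; map-tabulate; map-cong; filter-++; length-++)
import Data.List.Relation.Unary.All.Properties as All
import Data.List.Relation.Unary.Any.Properties as Any
open import Data.Nat
  using (ℕ; zero; suc; _+_; _*_; _∸_; _≤_; _<_; _<ᵇ_; _≡ᵇ_; _<?_; z≤n; s≤s; z<s; s<s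
        ; s≤s⁻¹; s<s⁻¹)
open import Data.Nat.Combinatorics using (_C_; _P_; nCk+nC[k+1]≡[n+1]C[k+1]; nCn≡1)
open import Data.Nat.Combinatorics.Base using (_P′_)
open import Data.Nat.ListAction using () renaming (sum to sumˡ)
open import Data.Nat.Properties
  using ( ≤-refl; ≤-trans; ≤-antisym; <-trans; <-≤-trans; <-asym; <-cmp; <⇒≤; <⇒≢; <⇒≱
        ; ≰⇒>; ≮⇒≥; ≤∧≢⇒<; m≤n⇒m<n∨m≡n; m<n⇒m<1+n; n<1+n; n≮0; n≢0⇒n>0
        ; suc-injective
        ; +-comm; +-assoc; +-identityʳ; *-identityʳ; *-zeroʳ; *-distribˡ-+
        ; +-0-monoid; *-commutativeSemigroup; <ᵇ⇒<; <⇒<ᵇ; ≡ᵇ⇒≡; ≡⇒≡ᵇ)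
open import Data.Product using (Σ; ∃; _×_; _,_; proj₁; proj₂; map₂)
open import Data.Product.Function.NonDependent.Propositional using (_×-⇔_)
open import Data.Refinement as Refinement using (Refinement-syntax; _,_; value; value-injective)
open import Data.Sum using (_⊎_; inj₁; inj₂; [_,_]′)
open import Data.Sum.Function.Propositional using (_⊎-↔_)
open import Data.Vec as Vec using (Vec; []; _∷_; lookup; insertAt; removeAt)
open import Data.Vec.Properties
  using ( ≡-dec; tabulate∘lookup; tabulate-cong; lookup-map; map-∘; map-id
        ; insertAt-lookup; insertAt-punchIn; removeAt-insertAt; removeAt-punchOut)
open import Defs
open import Function using (_∘_; id; flip; case_of_)
open import Function.Bundles using (_↔_; mk↔ₛ′; _⇔_; mk⇔; Equivalence)
open import Function.Construct.Composition using () renaming (equivalence to ⇔-trans)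
open import Function.Definitions using (Injective)
open import Function.Properties.Inverse using (↔-sym; ↔-trans)
open import Function.Related.TypeIsomorphisms using (→-cong-⇔; ¬-cong-⇔)
open import Relation.Binary.Definitions using (tri<; tri≈; tri>; _Respects_)
open import Relation.Binary.PropositionalEquality
  using (_≡_; _≢_; _≗_; refl; sym; trans; cong; cong₂; subst; subst₂; module ≡-Reasoning)
open import Relation.Nullary using (¬_; yes; no; contradiction; recompute)

open import Algebra.Properties.CommutativeSemigroup *-commutativeSemigroup using (x∙yz≈y∙xz)
open import Algebra.Properties.Monoid.Sum +-0-monoid using (sum-syntax)

¬⇒↔Fin0 : {A : Set} → ¬ A → A ↔ Fin 0
¬⇒↔Fin0 ¬a = mk↔ₛ′ (⊥-elim ∘ ¬a) (λ ()) (λ ()) (⊥-elim ∘ ¬a)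

resize : {A : Set} {m n : ℕ} → m ≡ n → A ↔ Fin m → A ↔ Fin n
resize refl a↔m = a↔m

size-unique : {A : Set} {m n : ℕ} → A ↔ Fin m → A ↔ Fin n → m ≡ n
size-unique a↔m a↔n = ↔⇒≡ (↔-trans (↔-sym a↔m) a↔n)

_⊎-size_ : {A B : Set} {m n : ℕ} → A ↔ Fin m → B ↔ Fin n → (A ⊎ B) ↔ Fin (m + n)
a↔m ⊎-size b↔n = ↔-trans (a↔m ⊎-↔ b↔n) (↔-sym +↔⊎)

refinement-empty : {A : Set} {P : A → Set} → (∀ x → ¬ P x) → ¬ [ x ∈ A ∣ P x ]
refinement-empty ¬P (x , [ px ]) = ⊥-elim-irr (¬P x px)

refinement-cong : {A : Set} {P Q : A → Set} → (∀ {x} → P x ⇔ Q x) →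
                  [ x ∈ A ∣ P x ] ↔ [ x ∈ A ∣ Q x ]
refinement-cong P⇔Q = mk↔ₛ′ (Refinement.map id (Equivalence.to P⇔Q))
                            (Refinement.map id (Equivalence.from P⇔Q)) (λ _ → refl) (λ _ → refl)

Σ-Fin-zero : (B : Fin 0 → Set) → Σ (Fin 0) B ↔ Fin 0
Σ-Fin-zero B = ¬⇒↔Fin0 λ ()

Σ-Fin-suc : {k : ℕ} (B : Fin (suc k) → Set) →
            Σ (Fin (suc k)) B ↔ (B fzero ⊎ Σ (Fin k) (B ∘ fsuc))
Σ-Fin-suc B = mk↔ₛ′ split join split-join join-split
  where
  split : Σ _ B → B fzero ⊎ Σ _ (B ∘ fsuc)
  split (fzero , b) = inj₁ b
  split (fsuc i , b) = inj₂ (i , b)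

  join : B fzero ⊎ Σ _ (B ∘ fsuc) → Σ _ B
  join (inj₁ b) = fzero , b
  join (inj₂ (i , b)) = fsuc i , b

  split-join : ∀ x → split (join x) ≡ x
  split-join (inj₁ b) = refl
  split-join (inj₂ (i , b)) = refl

  join-split : ∀ x → join (split x) ≡ x
  join-split (fzero , b) = refl
  join-split (fsuc i , b) = refl

Σ-Fin-sum : {k : ℕ} (B : Fin k → Set) (s : Fin k → ℕ) →
            (∀ i → B i ↔ Fin (s i)) → Σ (Fin k) B ↔ Fin (∑[ i < k ] s i)
Σ-Fin-sum {zero} B _ _ = Σ-Fin-zero B
Σ-Fin-sum {suc k} B s size =
  ↔-trans (Σ-Fin-suc B) (size fzero ⊎-size Σ-Fin-sum (B ∘ fsuc) (s ∘ fsuc) (size ∘ fsuc))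

Σ-Fin-last : {M d : ℕ} (B : Fin (suc M) → Set) →
             (∀ p → toℕ p < M → ¬ B p) → B (fromℕ M) ↔ Fin d → Σ (Fin (suc M)) B ↔ Fin d
Σ-Fin-last {zero} {d} B _ last =
  resize (+-identityʳ d) (↔-trans (Σ-Fin-suc B) (last ⊎-size Σ-Fin-zero _))
Σ-Fin-last {suc M} B before last =
  ↔-trans (Σ-Fin-suc B)
    (¬⇒↔Fin0 (before fzero z<s) ⊎-size Σ-Fin-last (B ∘ fsuc) (λ p → before (fsuc p) ∘ s<s) last)

Σ-Fin-profile : {M k c d : ℕ} (B : Fin (suc M) → Set) → k ≤ M →
                (∀ p → toℕ p < k → B p ↔ Fin c) →
                (∀ p → k ≤ toℕ p → toℕ p < M → ¬ B p) →
                B (fromℕ M) ↔ Fin d →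
                Σ (Fin (suc M)) B ↔ Fin (k * c + d)
Σ-Fin-profile {k = zero} B _ _ middle last = Σ-Fin-last B (λ p → middle p z≤n) last
Σ-Fin-profile {suc M} {suc k} {c} {d} B k≤M initial middle last =
  resize (sym (+-assoc c (k * c) d))
    (↔-trans (Σ-Fin-suc B)
      (initial fzero z<s ⊎-size
       Σ-Fin-profile (B ∘ fsuc) (s≤s⁻¹ k≤M) (λ p → initial (fsuc p) ∘ s<s)
         (λ p k≤p p<M → middle (fsuc p) (s≤s k≤p) (s<s p<M)) last))

Σ-Fin-two-point : {M x y : ℕ} (B : Fin (suc M) → Set) (q : Fin (suc M)) → toℕ q < M →
                  (∀ p → p ≢ q → toℕ p < M → ¬ B p) →
                  B q ↔ Fin x → B (fromℕ M) ↔ Fin y →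
                  Σ (Fin (suc M)) B ↔ Fin (x + y)
Σ-Fin-two-point {suc M} B fzero _ elsewhere at-q last =
  ↔-trans (Σ-Fin-suc B)
    (at-q ⊎-size Σ-Fin-last (B ∘ fsuc) (λ p → elsewhere (fsuc p) (λ ()) ∘ s<s) last)
Σ-Fin-two-point {suc M} B (fsuc q) q<M elsewhere at-q last =
  ↔-trans (Σ-Fin-suc B)
    (¬⇒↔Fin0 (elsewhere fzero (λ ()) z<s) ⊎-size
     Σ-Fin-two-point (B ∘ fsuc) q (s<s⁻¹ q<M)
       (λ p p≢q → elsewhere (fsuc p) (p≢q ∘ fsuc-injective) ∘ s<s) at-q last)

count : {A : Set} → (A → Bool) → List A → ℕ
count p xs = length (filterᵇ p xs)

count-++ : {A : Set} (p : A → Bool) (xs ys : List A) → count p (xs ++ ys) ≡ count p xs + count p ys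
count-++ p xs ys = trans (cong length (filter-++ (T? ∘ p) xs ys)) (length-++ (filterᵇ p xs))

count-concatMap : {A B : Set} (p : B → Bool) (h : A → List B) (xs : List A) →
                  count p (concatMap h xs) ≡ sumˡ (List.map (count p ∘ h) xs)
count-concatMap p h [] = refl
count-concatMap p h (x ∷ xs) =
  trans (count-++ p (h x) (concatMap h xs)) (cong (count p (h x) +_) (count-concatMap p h xs))

count-map : {A B : Set} (p : B → Bool) (f : A → B) (xs : List A) →
            count p (List.map f xs) ≡ count (p ∘ f) xs
count-map p f [] = refl
count-map p f (x ∷ xs) with p (f x)
... | true = cong suc (count-map p f xs)
... | false = count-map p f xs

sumˡ-map-allFin : {k : ℕ} (F : Fin k → ℕ) → sumˡ (List.map F (allFin k)) ≡ ∑[ i < k ] F i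
sumˡ-map-allFin F = trans (cong sumˡ (map-tabulate id F)) (sumˡ-tabulate F)
  where
  sumˡ-tabulate : ∀ {k} (F : Fin k → ℕ) → sumˡ (List.tabulate F) ≡ ∑[ i < k ] F i
  sumˡ-tabulate {zero} F = refl
  sumˡ-tabulate {suc k} F = cong (F fzero +_) (sumˡ-tabulate (F ∘ fsuc))

count-allFuns-zero : {m : ℕ} (p : (Fin 0 → Fin m) → Bool) → (T ∘ p) Respects _≗_ →
                     (f₀ : Fin 0 → Fin m) →
                     [ v ∈ Vec (Fin m) 0 ∣ T (p (lookup v)) ] ↔ Fin (count p (f₀ ∷ []))
count-allFuns-zero p p-resp f₀ with p f₀ in p-f₀
... | true = mk↔ₛ′ (λ _ → fzero) (λ _ → [] , [ p-resp (λ ()) (subst T (sym p-f₀) _) ])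
               (λ { fzero → refl ; (fsuc ()) }) (λ { ([] , _) → refl })
... | false = ¬⇒↔Fin0 (refinement-empty λ { [] t → subst T p-f₀ (p-resp (λ ()) t) })

-- allFuns builds its functions with an anonymous pattern lambda; cons stands for it through
-- its two computation rules.
count-allFuns-suc :
  {m n : ℕ} (cons : Fin m → (Fin n → Fin m) → Fin (suc n) → Fin m) →
  (∀ a f → cons a f fzero ≡ a) → (∀ a f i → cons a f (fsuc i) ≡ f i) →
  (∀ q → (T ∘ q) Respects _≗_ →
         [ v ∈ Vec (Fin m) n ∣ T (q (lookup v)) ] ↔ Fin (count q (allFuns n m))) →
  ∀ p → (T ∘ p) Respects _≗_ →
  [ v ∈ Vec (Fin m) (suc n) ∣ T (p (lookup v)) ] ↔
  Fin (count p (concatMap (λ a → List.map (cons a) (allFuns n m)) (allFin m)))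
count-allFuns-suc {m} {n} cons cons-zero cons-suc count-allFuns-n p p-resp =
  resize (sym counted)
    (↔-trans split-head (Σ-Fin-sum _ _ λ a → count-allFuns-n (p ∘ cons a) (p-resp ∘ cons-cong a)))
  where
  cons-cong : ∀ a {f g} → f ≗ g → cons a f ≗ cons a g
  cons-cong a {f} {g} f≗g fzero = trans (cons-zero a f) (sym (cons-zero a g))
  cons-cong a {f} {g} f≗g (fsuc i) = trans (cons-suc a f i) (trans (f≗g i) (sym (cons-suc a g i)))

  lookup-∷ : ∀ a (v : Vec (Fin m) n) → lookup (a ∷ v) ≗ cons a (lookup v)
  lookup-∷ a v fzero = sym (cons-zero a (lookup v))
  lookup-∷ a v (fsuc i) = sym (cons-suc a (lookup v) i)

  split-head : [ v ∈ Vec (Fin m) (suc n) ∣ T (p (lookup v)) ] ↔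
               Σ (Fin m) (λ a → [ v ∈ Vec (Fin m) n ∣ T (p (cons a (lookup v))) ])
  split-head = mk↔ₛ′
    (λ { ((a ∷ v) , [ t ]) → a , (v , [ p-resp (lookup-∷ a v) t ]) })
    (λ { (a , (v , [ t ])) → (a ∷ v) , [ p-resp (sym ∘ lookup-∷ a v) t ] })
    (λ _ → refl) (λ { ((_ ∷ _) , _) → refl })

  counted : count p (concatMap (λ a → List.map (cons a) (allFuns n m)) (allFin m)) ≡
            ∑[ a < m ] count (p ∘ cons a) (allFuns n m)
  counted = begin
    count p (concatMap (λ a → List.map (cons a) (allFuns n m)) (allFin m))
      ≡⟨ count-concatMap p _ (allFin m) ⟩
    sumˡ (List.map (λ a → count p (List.map (cons a) (allFuns n m))) (allFin m))
      ≡⟨ cong sumˡ (map-cong (λ a → count-map p (cons a) (allFuns n m)) (allFin m)) ⟩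
    sumˡ (List.map (λ a → count (p ∘ cons a) (allFuns n m)) (allFin m))
      ≡⟨ sumˡ-map-allFin (λ a → count (p ∘ cons a) (allFuns n m)) ⟩
    ∑[ a < m ] count (p ∘ cons a) (allFuns n m)
      ∎
    where open ≡-Reasoning

count-allFuns : {m : ℕ} (n : ℕ) (p : (Fin n → Fin m) → Bool) → (T ∘ p) Respects _≗_ →
                [ v ∈ Vec (Fin m) n ∣ T (p (lookup v)) ] ↔ Fin (count p (allFuns n m))
count-allFuns zero p p-resp = count-allFuns-zero p p-resp _
count-allFuns (suc n) = count-allFuns-suc _ (λ _ _ → refl) (λ _ _ _ → refl) (count-allFuns n)

injective⇒surjective : {n : ℕ} {f : Fin n → Fin n} → Injective _≡_ _≡_ f →
                       ∀ y → ∃ λ x → f x ≡ y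
injective⇒surjective {suc N} {f} f-inj y with any? (λ x → f x ≟ y)
... | yes hit = hit
... | no miss with pigeonhole (n<1+n N) (λ x → punchOut (miss ∘ (x ,_) ∘ sym))
...   | i , j , i<j , fi≡fj =
  contradiction (f-inj (punchOut-injective (miss ∘ (i ,_) ∘ sym) (miss ∘ (j ,_) ∘ sym) fi≡fj))
                (<⇒≢ i<j ∘ cong toℕ)

next : {N : ℕ} (p : Fin (suc N)) → toℕ p < N → Fin (suc N)
next p p<N = fromℕ< (s≤s p<N)

toℕ-next : {N : ℕ} (p : Fin (suc N)) (p<N : toℕ p < N) → toℕ (next p p<N) ≡ suc (toℕ p)
toℕ-next p p<N = toℕ-fromℕ< (s≤s p<N)

toℕ<toℕ-next : {N : ℕ} (p : Fin (suc N)) (p<N : toℕ p < N) → toℕ p < toℕ (next p p<N)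
toℕ<toℕ-next p p<N = subst (toℕ p <_) (sym (toℕ-next p p<N)) (n<1+n (toℕ p))

toℕ-punchIn-< : {N : ℕ} (p : Fin (suc N)) (j : Fin N) →
                toℕ j < toℕ p → toℕ (punchIn p j) ≡ toℕ j
toℕ-punchIn-< (fsuc p) fzero _ = refl
toℕ-punchIn-< (fsuc p) (fsuc j) j<p = cong suc (toℕ-punchIn-< p j (s<s⁻¹ j<p))

toℕ-punchIn-≥ : {N : ℕ} (p : Fin (suc N)) (j : Fin N) →
                toℕ p ≤ toℕ j → toℕ (punchIn p j) ≡ suc (toℕ j)
toℕ-punchIn-≥ fzero j _ = refl
toℕ-punchIn-≥ (fsuc p) (fsuc j) p≤j = cong suc (toℕ-punchIn-≥ p j (s≤s⁻¹ p≤j))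

module _ {N : ℕ} (p : Fin (suc N)) where

  punchIn-mono-< : ∀ {i j} → toℕ i < toℕ j → toℕ (punchIn p i) < toℕ (punchIn p j)
  punchIn-mono-< {i} {j} i<j = ≰⇒> λ le → <⇒≱ i<j (punchIn-cancel-≤ p j i le)

  punchIn-cancel-< : ∀ {i j} → toℕ (punchIn p i) < toℕ (punchIn p j) → toℕ i < toℕ j
  punchIn-cancel-< {i} {j} lt = ≰⇒> λ le → <⇒≱ lt (punchIn-mono-≤ p j i le)

  data PositionView : Fin (suc N) → Set where
    at : PositionView p
    off : (j : Fin N) → PositionView (punchIn p j)

  positionView : ∀ i → PositionView i
  positionView i with i ≟ p
  ... | yes refl = at
  ... | no i≢p = subst PositionView (punchIn-punchOut (i≢p ∘ sym)) (off (punchOut (i≢p ∘ sym)))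

module _ {n : ℕ} where

  Has3|12 : ℕ → (Fin n → Fin n) → Set
  Has3|12 r w = ∃ λ a → ∃ λ b → ∃ λ c →
    toℕ a < r × r ≤ toℕ b × toℕ b < toℕ c × toℕ (w b) < toℕ (w c) × toℕ (w c) < toℕ (w a)

  Has23|1 : ℕ → (Fin n → Fin n) → Set
  Has23|1 r w = ∃ λ a → ∃ λ b → ∃ λ c →
    toℕ a < toℕ b × toℕ b < r × r ≤ toℕ c × toℕ (w c) < toℕ (w a) × toℕ (w a) < toℕ (w b)

  MaxOnLeft : ℕ → (Fin n → Fin n) → Set
  MaxOnLeft r w = ∃ λ k → toℕ k < r × suc (toℕ (w k)) ≡ n

  -- Equivalent to MaxOnLeft for permutations of a nonempty set, but unlike it also true of the
  -- empty permutation, which the recursion needs as the base case |K_L↓(0, 0)| = 1.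
  NoMaxOnRight : ℕ → (Fin n → Fin n) → Set
  NoMaxOnRight r w = ∀ k → r ≤ toℕ k → suc (toℕ (w k)) ≢ n

  LeftDecreasing : ℕ → (Fin n → Fin n) → Set
  LeftDecreasing r w = ∀ a b → toℕ a < toℕ b → toℕ b < r → toℕ (w b) < toℕ (w a)

  record InKL (r : ℕ) (w : Fin n → Fin n) : Set where
    field
      injective : Injective _≡_ _≡_ w
      avoids3|12 : ¬ Has3|12 r w
      avoids23|1 : ¬ Has23|1 r w
      noMaxOnRight : NoMaxOnRight r w

  InKL↓ : ℕ → (Fin n → Fin n) → Set
  InKL↓ r w = InKL r w × LeftDecreasing r w

  InKL↓⇒injective : ∀ {r w} → InKL↓ r w → Injective _≡_ _≡_ w
  InKL↓⇒injective = InKL.injective ∘ proj₁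

  maxOnLeft⇒noMaxOnRight : ∀ {r w} → Injective _≡_ _≡_ w → MaxOnLeft r w → NoMaxOnRight r w
  maxOnLeft⇒noMaxOnRight w-inj (k , k<r , w-k) k′ r≤k′ w-k′ =
    <⇒≱ k<r (subst (λ i → _ ≤ toℕ i) k′≡k r≤k′)
    where
    k′≡k : k′ ≡ k
    k′≡k = w-inj (toℕ-injective (suc-injective (trans w-k′ (sym w-k))))

  InKL-respects-≗ : ∀ {r} → InKL r Respects _≗_
  InKL-respects-≗ {x = f} {g} f≗g kl = record
    { injective = λ {x} {y} gx≡gy → injective (trans (f≗g x) (trans gx≡gy (sym (f≗g y))))
    ; avoids3|12 = λ (a , b , c , a<r , r≤b , b<c , gb<gc , gc<ga) →
        avoids3|12 (a , b , c , a<r , r≤b , b<c , to-f b c gb<gc , to-f c a gc<ga)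
    ; avoids23|1 = λ (a , b , c , a<b , b<r , r≤c , gc<ga , ga<gb) →
        avoids23|1 (a , b , c , a<b , b<r , r≤c , to-f c a gc<ga , to-f a b ga<gb)
    ; noMaxOnRight = λ k r≤k gk-max → noMaxOnRight k r≤k (trans (cong (suc ∘ toℕ) (f≗g k)) gk-max)
    }
    where
    open InKL kl
    to-f : ∀ x y → toℕ (g x) < toℕ (g y) → toℕ (f x) < toℕ (f y)
    to-f x y = subst₂ (λ u v → toℕ u < toℕ v) (sym (f≗g x)) (sym (f≗g y))

inKL↓-empty : ∀ {r} {w : Fin 0 → Fin 0} → InKL↓ r w
inKL↓-empty =
  record { injective = λ { {()} } ; avoids3|12 = λ () ; avoids23|1 = λ () ; noMaxOnRight = λ () } , λ ()

module _ {N : ℕ} {w : Fin (suc N) → Fin (suc N)} where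

  noMaxOnRight⇒maxOnLeft : ∀ {r} → Injective _≡_ _≡_ w → NoMaxOnRight r w → MaxOnLeft r w
  noMaxOnRight⇒maxOnLeft w-inj noMax with injective⇒surjective w-inj (fromℕ N)
  ... | k , w-k≡N = k , ≰⇒> (λ r≤k → noMax k r≤k k-max) , k-max
    where
    k-max : suc (toℕ (w k)) ≡ suc N
    k-max = cong suc (trans (cong toℕ w-k≡N) (toℕ-fromℕ N))

  ¬InKL0 : ¬ InKL 0 w
  ¬InKL0 kl with noMaxOnRight⇒maxOnLeft (InKL.injective kl) (InKL.noMaxOnRight kl)
  ... | _ , () , _

T-not : ∀ {b} → T (not b) ⇔ (¬ T b)
T-not {true} = mk⇔ (λ ()) (λ ¬t → ¬t _)
T-not {false} = mk⇔ (λ _ ()) (λ _ → _)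

T-implies : ∀ {x y} → T (not x ∨ y) ⇔ (T x → T y)
T-implies {true} {true} = mk⇔ (λ _ _ → _) (λ _ → _)
T-implies {true} {false} = mk⇔ (λ ()) (λ f → f _)
T-implies {false} = mk⇔ (λ _ ()) (λ _ → _)

module _ {x y : Bool} {A B : Set} where

  infixr 6 _∧-⇔_

  _∧-⇔_ : T x ⇔ A → T y ⇔ B → T (x ∧ y) ⇔ (A × B)
  x⇔A ∧-⇔ y⇔B = ⇔-trans T-∧ (x⇔A ×-⇔ y⇔B)

  _⇒-⇔_ : T x ⇔ A → T y ⇔ B → T (not x ∨ y) ⇔ (A → B)
  x⇔A ⇒-⇔ y⇔B = ⇔-trans T-implies (→-cong-⇔ x⇔A y⇔B)

not-⇔ : {x : Bool} {A : Set} → T x ⇔ A → T (not x) ⇔ (¬ A)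
not-⇔ x⇔A = ⇔-trans T-not (¬-cong-⇔ x⇔A)

T-<ᵇ : ∀ {m n} → T (m <ᵇ n) ⇔ m < n
T-<ᵇ {m} {n} = mk⇔ (<ᵇ⇒< m n) <⇒<ᵇ

T-not-<ᵇ : ∀ {m n} → T (not (m <ᵇ n)) ⇔ n ≤ m
T-not-<ᵇ = ⇔-trans (not-⇔ T-<ᵇ) (mk⇔ ≮⇒≥ (flip <⇒≱))

T-≡ᵇ : ∀ {m n} → T (m ≡ᵇ n) ⇔ m ≡ n
T-≡ᵇ {m} {n} = mk⇔ (≡ᵇ⇒≡ m n) (≡⇒≡ᵇ m n)

module _ {n : ℕ} {p : Fin n → Bool} {P : Fin n → Set} (p⇔P : ∀ i → T (p i) ⇔ P i) where

  T-∀ᵇ : T (∀ᵇ p) ⇔ (∀ i → P i)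
  T-∀ᵇ = mk⇔ (λ t i → Equivalence.to (p⇔P i) (All.tabulate⁻ (All.all⁺ p (allFin n) t) i))
             (λ h → All.all⁻ p (All.tabulate⁺ λ i → Equivalence.from (p⇔P i) (h i)))

  T-∃ᵇ : T (∃ᵇ p) ⇔ ∃ P
  T-∃ᵇ = mk⇔ (λ t → map₂ (Equivalence.to (p⇔P _)) (Any.tabulate⁻ (Any.any⁻ p (allFin n) t)))
             (λ (i , Pi) → Any.any⁺ p (Any.tabulate⁺ i (Equivalence.from (p⇔P i) Pi)))

T-isPerm : ∀ {n} {w : Fin n → Fin n} → T (isPerm w) ⇔ Injective _≡_ _≡_ w
T-isPerm = ⇔-trans (T-∀ᵇ λ i → T-∀ᵇ λ j → T-≡ᵇ ⇒-⇔ T-≡ᵇ) (mk⇔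
  (λ inj {i} {j} w-i≡w-j → toℕ-injective (inj i j (cong toℕ w-i≡w-j)))
  (λ inj i j w-i≡w-j → cong toℕ (inj (toℕ-injective w-i≡w-j))))

module _ {n r : ℕ} {w : Fin n → Fin n} where

  T-contains3|12 : T (contains3|12 r w) ⇔ Has3|12 r w
  T-contains3|12 = T-∃ᵇ λ a → T-∃ᵇ λ b → T-∃ᵇ λ c →
    T-<ᵇ ∧-⇔ T-not-<ᵇ ∧-⇔ T-<ᵇ ∧-⇔ T-<ᵇ ∧-⇔ T-<ᵇ

  T-contains23|1 : T (contains23|1 r w) ⇔ Has23|1 r w
  T-contains23|1 = T-∃ᵇ λ a → T-∃ᵇ λ b → T-∃ᵇ λ c →
    T-<ᵇ ∧-⇔ T-<ᵇ ∧-⇔ T-not-<ᵇ ∧-⇔ T-<ᵇ ∧-⇔ T-<ᵇ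

  T-maxInLeft : T (maxInLeft r w) ⇔ MaxOnLeft r w
  T-maxInLeft = T-∃ᵇ λ k → T-<ᵇ ∧-⇔ T-≡ᵇ

T-inKL : ∀ {N r} {w : Fin (suc N) → Fin (suc N)} → T (inKL r w) ⇔ InKL r w
T-inKL = ⇔-trans
  ((T-isPerm ∧-⇔ not-⇔ T-contains3|12 ∧-⇔ not-⇔ T-contains23|1) ∧-⇔ T-maxInLeft) (mk⇔
  (λ ((inj , no3|12 , no23|1) , maxOnLeft) →
    record { injective = inj ; avoids3|12 = no3|12 ; avoids23|1 = no23|1
           ; noMaxOnRight = maxOnLeft⇒noMaxOnRight inj maxOnLeft })
  (λ kl → let open InKL kl in
    (injective , avoids3|12 , avoids23|1) , noMaxOnRight⇒maxOnLeft injective noMaxOnRight))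

inKL-respects-≗ : ∀ {N} r → (T ∘ inKL {suc N} r) Respects _≗_
inKL-respects-≗ r f≗g =
  Equivalence.from T-inKL ∘ InKL-respects-≗ f≗g ∘ Equivalence.to (T-inKL {r = r})

-- Where the entry 1 can be

module _ {N r : ℕ} {w : Fin (suc N) → Fin (suc N)} {p : Fin (suc N)} (w-p : w p ≡ fzero) where

  minimum-on-right-is-last : InKL r w → r ≤ toℕ p → toℕ p ≡ N
  minimum-on-right-is-last kl r≤p with noMaxOnRight⇒maxOnLeft (InKL.injective kl) (InKL.noMaxOnRight kl)
  ... | k , k<r , w-k = ≤-antisym (s≤s⁻¹ (toℕ<n p)) (≮⇒≥ λ p<N →
        avoids3|12 (k , p , next p p<N , k<r , r≤p , toℕ<toℕ-next p p<N ,
                    w-p<w-next p<N , w-next<w-k p<N))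
    where
    open InKL kl

    w-p<w-next : ∀ p<N → toℕ (w p) < toℕ (w (next p p<N))
    w-p<w-next p<N = subst (_< toℕ (w (next p p<N))) (sym (cong toℕ w-p)) (n≢0⇒n>0 λ w-next≡0 →
      <⇒≢ (toℕ<toℕ-next p p<N) (cong toℕ (injective (trans w-p (sym (toℕ-injective w-next≡0))))))

    w-next<w-k : ∀ p<N → toℕ (w (next p p<N)) < toℕ (w k)
    w-next<w-k p<N =
      ≤∧≢⇒< (subst (toℕ (w (next p p<N)) ≤_) (sym (suc-injective w-k))
                   (s≤s⁻¹ (toℕ<n (w (next p p<N)))))
            λ w-next≡w-k → <⇒≢ (<-trans (<-≤-trans k<r r≤p) (toℕ<toℕ-next p p<N))
                                (cong toℕ (injective (toℕ-injective (sym w-next≡w-k))))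

  decreasing-left-ends-by-minimum : LeftDecreasing r w → toℕ p < N → r ≤ suc (toℕ p)
  decreasing-left-ends-by-minimum decreasing p<N = ≮⇒≥ λ p+1<r →
    n≮0 (subst (toℕ (w (next p p<N)) <_) (cong toℕ w-p)
      (decreasing p (next p p<N) (toℕ<toℕ-next p p<N) (subst (_< r) (sym (toℕ-next p p<N)) p+1<r)))

module MinimumInsertion {N : ℕ} {w : Fin (suc N) → Fin (suc N)} {g : Fin N → Fin N} {p : Fin (suc N)}
                        (w-p : w p ≡ fzero) (w-punchIn : ∀ j → w (punchIn p j) ≡ fsuc (g j)) where

  private
    toℕ-w-punchIn : ∀ j → toℕ (w (punchIn p j)) ≡ suc (toℕ (g j))
    toℕ-w-punchIn j = cong toℕ (w-punchIn j)

    w-mono : ∀ {a b} → toℕ (g a) < toℕ (g b) → toℕ (w (punchIn p a)) < toℕ (w (punchIn p b))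
    w-mono {a} {b} lt rewrite toℕ-w-punchIn a | toℕ-w-punchIn b = s<s lt

    w-cancel : ∀ {a b} → toℕ (w (punchIn p a)) < toℕ (w (punchIn p b)) → toℕ (g a) < toℕ (g b)
    w-cancel {a} {b} lt rewrite toℕ-w-punchIn a | toℕ-w-punchIn b = s<s⁻¹ lt

    ¬<w-p : ∀ i → ¬ toℕ (w i) < toℕ (w p)
    ¬<w-p i rewrite w-p = n≮0

    w-p< : ∀ j → toℕ (w p) < toℕ (w (punchIn p j))
    w-p< j rewrite w-p | toℕ-w-punchIn j = z<s

  injective⇔ : Injective _≡_ _≡_ w ⇔ Injective _≡_ _≡_ g
  injective⇔ = mk⇔ to from
    where
    to : Injective _≡_ _≡_ w → Injective _≡_ _≡_ g
    to w-inj {a} {b} eq =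
      punchIn-injective p a b (w-inj (trans (w-punchIn a) (trans (cong fsuc eq) (sym (w-punchIn b)))))

    from : Injective _≡_ _≡_ g → Injective _≡_ _≡_ w
    from g-inj {i} {j} eq with positionView p i | positionView p j
    ... | at | at = refl
    ... | at | off b = contradiction (trans (sym w-p) (trans eq (w-punchIn b))) λ ()
    ... | off a | at = contradiction (trans (sym w-p) (trans (sym eq) (w-punchIn a))) λ ()
    ... | off a | off b =
      cong (punchIn p) (g-inj (fsuc-injective (trans (sym (w-punchIn a)) (trans eq (w-punchIn b)))))

  SameLeft : ℕ → ℕ → Set
  SameLeft rw rg = ∀ j → toℕ (punchIn p j) < rw ⇔ toℕ j < rg

  sameLeft-left : ∀ {r} → toℕ p ≤ r → SameLeft (suc r) r
  sameLeft-left p≤r j with toℕ j <? toℕ p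
  ... | yes j<p rewrite toℕ-punchIn-< p j j<p = mk⇔ (λ _ → <-≤-trans j<p p≤r) m<n⇒m<1+n
  ... | no j≮p rewrite toℕ-punchIn-≥ p j (≮⇒≥ j≮p) = mk⇔ s<s⁻¹ s<s

  sameLeft-right : ∀ {r} → r ≤ toℕ p → SameLeft r r
  sameLeft-right r≤p j with toℕ j <? toℕ p
  ... | yes j<p rewrite toℕ-punchIn-< p j j<p = mk⇔ id id
  ... | no j≮p rewrite toℕ-punchIn-≥ p j (≮⇒≥ j≮p) =
    mk⇔ (<-trans (n<1+n _)) λ j<r → contradiction (≤-trans r≤p (≮⇒≥ j≮p)) (<⇒≱ j<r)

  module Regions {rw rg : ℕ} (same : SameLeft rw rg) where

    private
      left⇒ : ∀ {j} → toℕ (punchIn p j) < rw → toℕ j < rg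
      left⇒ = Equivalence.to (same _)

      ⇒left : ∀ {j} → toℕ j < rg → toℕ (punchIn p j) < rw
      ⇒left = Equivalence.from (same _)

      right⇒ : ∀ {j} → rw ≤ toℕ (punchIn p j) → rg ≤ toℕ j
      right⇒ rw≤ = ≮⇒≥ λ lt → <⇒≱ (⇒left lt) rw≤

      ⇒right : ∀ {j} → rg ≤ toℕ j → rw ≤ toℕ (punchIn p j)
      ⇒right rg≤ = ≮⇒≥ λ lt → <⇒≱ (left⇒ lt) rg≤

    lift-3|12 : Has3|12 rg g → Has3|12 rw w
    lift-3|12 (a , b , c , a<r , r≤b , b<c , gb<gc , gc<ga) =
      punchIn p a , punchIn p b , punchIn p c ,
      ⇒left a<r , ⇒right r≤b , punchIn-mono-< p b<c , w-mono gb<gc , w-mono gc<ga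

    lift-23|1 : Has23|1 rg g → Has23|1 rw w
    lift-23|1 (a , b , c , a<b , b<r , r≤c , gc<ga , ga<gb) =
      punchIn p a , punchIn p b , punchIn p c ,
      punchIn-mono-< p a<b , ⇒left b<r , ⇒right r≤c , w-mono gc<ga , w-mono ga<gb

    -- w(p) is the smallest value, so p can only play the role of the 1 of a pattern.
    pull-3|12 : Has3|12 rw w → Has3|12 rg g ⊎ (rw ≤ toℕ p × ∃ λ c → toℕ p < toℕ c)
    pull-3|12 (a , b , c , a<r , r≤b , b<c , wb<wc , wc<wa)
      with positionView p a | positionView p b | positionView p c
    ... | _ | at | _ = inj₂ (r≤b , c , b<c)
    ... | _ | off _ | at = contradiction wb<wc (¬<w-p _)
    ... | at | off _ | off _ = contradiction wc<wa (¬<w-p _)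
    ... | off a′ | off b′ | off c′ =
      inj₁ (a′ , b′ , c′ , left⇒ a<r , right⇒ r≤b , punchIn-cancel-< p b<c ,
            w-cancel wb<wc , w-cancel wc<wa)

    pull-23|1 : Has23|1 rw w → Has23|1 rg g ⊎ (rw ≤ toℕ p × ¬ LeftDecreasing rg g)
    pull-23|1 (a , b , c , a<b , b<r , r≤c , wc<wa , wa<wb)
      with positionView p a | positionView p b | positionView p c
    ... | at | _ | _ = contradiction wc<wa (¬<w-p _)
    ... | off _ | at | _ = contradiction wa<wb (¬<w-p _)
    ... | off a′ | off b′ | at =
      inj₂ (r≤c , λ decreasing →
        <-asym (w-cancel wa<wb) (decreasing a′ b′ (punchIn-cancel-< p a<b) (left⇒ b<r)))
    ... | off a′ | off b′ | off c′ =
      inj₁ (a′ , b′ , c′ , punchIn-cancel-< p a<b , left⇒ b<r , right⇒ r≤c ,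
            w-cancel wc<wa , w-cancel wa<wb)

    pull-decreasing : LeftDecreasing rw w → LeftDecreasing rg g
    pull-decreasing decreasing a b a<b b<r =
      w-cancel (decreasing (punchIn p a) (punchIn p b) (punchIn-mono-< p a<b) (⇒left b<r))

    push-decreasing : (∀ i → toℕ p < toℕ i → rw ≤ toℕ i) →
                      LeftDecreasing rg g → LeftDecreasing rw w
    push-decreasing after-p-right decreasing a b a<b b<r with positionView p a | positionView p b
    ... | at | _ = contradiction (after-p-right b a<b) (<⇒≱ b<r)
    ... | off a′ | at = w-p< a′
    ... | off a′ | off b′ = w-mono (decreasing a′ b′ (punchIn-cancel-< p a<b) (left⇒ b<r))

    pull-noMaxOnRight : NoMaxOnRight rw w → NoMaxOnRight rg g
    pull-noMaxOnRight noMax k r≤k gk-max =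
      noMax (punchIn p k) (⇒right r≤k) (trans (cong suc (toℕ-w-punchIn k)) (cong suc gk-max))

    push-noMaxOnRight : (N ≡ 0 → toℕ p < rw) → NoMaxOnRight rg g → NoMaxOnRight rw w
    push-noMaxOnRight p-left-if-alone noMax k r≤k wk-max with positionView p k
    ... | at = contradiction r≤k
                 (<⇒≱ (p-left-if-alone (suc-injective (trans (sym wk-max) (cong (suc ∘ toℕ) w-p)))))
    ... | off j = noMax j (right⇒ r≤k) (suc-injective (trans (cong suc (sym (toℕ-w-punchIn j))) wk-max))

    inKL⇒ : InKL rw w → InKL rg g
    inKL⇒ kl = record
      { injective = Equivalence.to injective⇔ injective
      ; avoids3|12 = avoids3|12 ∘ lift-3|12
      ; avoids23|1 = avoids23|1 ∘ lift-23|1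
      ; noMaxOnRight = pull-noMaxOnRight noMaxOnRight
      }
      where open InKL kl

    ⇒inKL : (rw ≤ toℕ p → (∀ c → toℕ c ≤ toℕ p) × LeftDecreasing rg g) →
            (N ≡ 0 → toℕ p < rw) → InKL rg g → InKL rw w
    ⇒inKL p-right⇒ p-left-if-alone kl = record
      { injective = Equivalence.from injective⇔ injective
      ; avoids3|12 = [ avoids3|12 , (λ (r≤p , c , p<c) → <⇒≱ p<c (proj₁ (p-right⇒ r≤p) c)) ]′
                     ∘ pull-3|12
      ; avoids23|1 = [ avoids23|1 , (λ (r≤p , ascent) → ascent (proj₂ (p-right⇒ r≤p))) ]′
                     ∘ pull-23|1
      ; noMaxOnRight = push-noMaxOnRight p-left-if-alone noMaxOnRight
      }
      where open InKL kl

  inKL-left : ∀ {r} → toℕ p ≤ r → InKL (suc r) w ⇔ InKL r g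
  inKL-left p≤r = mk⇔ inKL⇒ (⇒inKL (λ r<p → contradiction r<p (<⇒≱ (s≤s p≤r)))
                                   (λ _ → s≤s p≤r))
    where open Regions (sameLeft-left p≤r)

  inKL↓-left : ∀ {r} → toℕ p ≡ r → InKL↓ (suc r) w ⇔ InKL↓ r g
  inKL↓-left refl = mk⇔
    (λ (kl , decreasing) → Equivalence.to (inKL-left ≤-refl) kl , pull-decreasing decreasing)
    (λ (kl , decreasing) → Equivalence.from (inKL-left ≤-refl) kl ,
                           push-decreasing (λ _ → id) decreasing)
    where open Regions (sameLeft-left ≤-refl)

  inKL-last : ∀ {r} → 1 ≤ r → r ≤ N → toℕ p ≡ N → InKL r w ⇔ InKL↓ r g
  inKL-last {r} 1≤r r≤N p-last = mk⇔
    (λ kl → inKL⇒ kl , decreasing kl)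
    (λ (kl , decreasing) →
      ⇒inKL (λ _ → (λ c → subst (toℕ c ≤_) (sym p-last) (s≤s⁻¹ (toℕ<n c))) , decreasing)
            (λ N≡0 → <-≤-trans (subst (_< 1) (sym (trans p-last N≡0)) z<s) 1≤r) kl)
    where
    r≤p : r ≤ toℕ p
    r≤p = subst (r ≤_) (sym p-last) r≤N
    open Regions (sameLeft-right r≤p)

    -- An ascent of g on the left would form 23|1 with the final 1 of w.
    decreasing : InKL r w → LeftDecreasing r g
    decreasing kl a b a<b b<r with <-cmp (toℕ (g a)) (toℕ (g b))
    ... | tri< ga<gb _ _ = contradiction
          (punchIn p a , punchIn p b , p , punchIn-mono-< p a<b ,
           Equivalence.from (sameLeft-right r≤p b) b<r , r≤p , w-p< a , w-mono ga<gb)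
          (InKL.avoids23|1 kl)
    ... | tri≈ _ ga≡gb _ =
          contradiction (Equivalence.to injective⇔ (InKL.injective kl) (toℕ-injective ga≡gb))
                        (<⇒≢ a<b ∘ cong toℕ)
    ... | tri> _ _ gb<ga = gb<ga

  inKL↓-last : ∀ {r} → 1 ≤ r → r ≤ N → toℕ p ≡ N → InKL↓ r w ⇔ InKL↓ r g
  inKL↓-last {r} 1≤r r≤N p-last = mk⇔
    (Equivalence.to (inKL-last 1≤r r≤N p-last) ∘ proj₁)
    (λ kl↓ → Equivalence.from (inKL-last 1≤r r≤N p-last) kl↓ ,
             push-decreasing (λ _ p<i → ≤-trans r≤p (<⇒≤ p<i)) (proj₂ kl↓))
    where
    r≤p : r ≤ toℕ p
    r≤p = subst (r ≤_) (sym p-last) r≤N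
    open Regions (sameLeft-right r≤p)

-- Deleting and inserting the entry 1

lookup-injective : {A : Set} {n : ℕ} {xs ys : Vec A n} → lookup xs ≗ lookup ys → xs ≡ ys
lookup-injective {xs = xs} {ys} eq =
  trans (sym (tabulate∘lookup xs)) (trans (tabulate-cong eq) (tabulate∘lookup ys))

lookup-removeAt : {A : Set} {n : ℕ} (v : Vec A (suc n)) (p : Fin (suc n)) (j : Fin n) →
                  lookup (removeAt v p) j ≡ lookup v (punchIn p j)
lookup-removeAt v p j = trans (cong (lookup (removeAt v p)) (sym (punchOut-punchIn p)))
                              (removeAt-punchOut v (punchInᵢ≢i p j ∘ sym))

-- Lowers every entry by one, except that an entry 0 stays 0.
lowerAll : {N : ℕ} → Vec (Fin (suc N)) N → Vec (Fin N) N
lowerAll {zero} [] = []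
lowerAll {suc N} = Vec.map (pinch fzero)

lowerAll-map-suc : {N : ℕ} (u : Vec (Fin N) N) → lowerAll (Vec.map fsuc u) ≡ u
lowerAll-map-suc {zero} [] = refl
lowerAll-map-suc {suc N} u = trans (sym (map-∘ (pinch fzero) fsuc u)) (map-id u)

lookup-lowerAll : {N : ℕ} (v : Vec (Fin (suc N)) N) (j : Fin N) →
                  lookup v j ≢ fzero → fsuc (lookup (lowerAll v) j) ≡ lookup v j
lookup-lowerAll {suc N} v j v-j≢0 rewrite lookup-map j (pinch fzero) v with lookup v j
... | fzero = contradiction refl v-j≢0
... | fsuc _ = refl

insertMin : {N : ℕ} → Fin (suc N) → Vec (Fin N) N → Vec (Fin (suc N)) (suc N)
insertMin p u = insertAt (Vec.map fsuc u) p fzero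

removeMin : {N : ℕ} → Fin (suc N) → Vec (Fin (suc N)) (suc N) → Vec (Fin N) N
removeMin p v = lowerAll (removeAt v p)

module _ {N : ℕ} (p : Fin (suc N)) where

  lookup-insertMin-p : ∀ u → lookup (insertMin p u) p ≡ fzero
  lookup-insertMin-p u = insertAt-lookup (Vec.map fsuc u) p fzero

  lookup-insertMin-punchIn : ∀ u j → lookup (insertMin p u) (punchIn p j) ≡ fsuc (lookup u j)
  lookup-insertMin-punchIn u j = trans (insertAt-punchIn (Vec.map fsuc u) p fzero j) (lookup-map j fsuc u)

  removeMin-insertMin : ∀ u → removeMin p (insertMin p u) ≡ u
  removeMin-insertMin u =
    trans (cong lowerAll (removeAt-insertAt (Vec.map fsuc u) p fzero)) (lowerAll-map-suc u)

  insertMin-removeMin : ∀ v → lookup v p ≡ fzero → Injective _≡_ _≡_ (lookup v) →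
                        insertMin p (removeMin p v) ≡ v
  insertMin-removeMin v v-p v-inj = lookup-injective λ i → pointwise i (positionView p i)
    where
    pointwise : ∀ i → PositionView p i → lookup (insertMin p (removeMin p v)) i ≡ lookup v i
    pointwise _ at = trans (lookup-insertMin-p _) (sym v-p)
    pointwise _ (off j) = begin
      lookup (insertMin p (removeMin p v)) (punchIn p j)  ≡⟨ lookup-insertMin-punchIn _ j ⟩
      fsuc (lookup (removeMin p v) j)                     ≡⟨ lookup-lowerAll _ j removed-j≢0 ⟩
      lookup (removeAt v p) j                             ≡⟨ lookup-removeAt v p j ⟩
      lookup v (punchIn p j)                              ∎
      where
      open ≡-Reasoning
      removed-j≢0 : lookup (removeAt v p) j ≢ fzero
      removed-j≢0 eq = punchInᵢ≢i p j (v-inj (trans (sym (lookup-removeAt v p j)) (trans eq (sym v-p))))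

module Inserted {N : ℕ} (p : Fin (suc N)) (u : Vec (Fin N) N) =
  MinimumInsertion {w = lookup (insertMin p u)} {g = lookup u} {p = p}
                   (lookup-insertMin-p p u) (lookup-insertMin-punchIn p u)

module _ {N : ℕ} (Q : (Fin (suc N) → Fin (suc N)) → Set) where

  MinAt : Fin (suc N) → Set
  MinAt p = [ v ∈ Vec (Fin (suc N)) (suc N) ∣ Q (lookup v) × lookup v p ≡ fzero ]

  split-by-minimum : (∀ {w} → Q w → Injective _≡_ _≡_ w) →
                     [ v ∈ Vec (Fin (suc N)) (suc N) ∣ Q (lookup v) ] ↔ Σ (Fin (suc N)) MinAt
  split-by-minimum Q⇒injective = mk↔ₛ′ split merge split-merge (λ _ → refl)
    where
    -- The proof of Q is irrelevant, so the position of the 0 is recomputed by search.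
    minimum : ∀ v → .(Q (lookup v)) → ∃ λ p → lookup v p ≡ fzero
    minimum v q =
      recompute (any? λ i → lookup v i ≟ fzero) (injective⇒surjective (Q⇒injective q) fzero)

    split : [ v ∈ Vec (Fin (suc N)) (suc N) ∣ Q (lookup v) ] → Σ (Fin (suc N)) MinAt
    split (v , [ q ]) = proj₁ (minimum v q) , (v , [ q , proj₂ (minimum v q) ])

    merge : Σ (Fin (suc N)) MinAt → [ v ∈ Vec (Fin (suc N)) (suc N) ∣ Q (lookup v) ]
    merge (_ , (v , [ q,v-p ])) = v , [ proj₁ q,v-p ]

    same-position : ∀ {p p′ v} .{x y} → p ≡ p′ →
                    _≡_ {A = Σ (Fin (suc N)) MinAt} (p , (v , [ x ])) (p′ , (v , [ y ]))
    same-position refl = refl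

    split-merge : ∀ x → split (merge x) ≡ x
    split-merge (p , (v , [ q,v-p ])) = same-position (recompute (_ ≟ p)
      (Q⇒injective (proj₁ q,v-p) (trans (proj₂ (minimum v (proj₁ q,v-p))) (sym (proj₂ q,v-p)))))

  module _ {p : Fin (suc N)} where

    minAt-empty : (∀ {w} → Q w → w p ≡ fzero → ⊥) → ¬ MinAt p
    minAt-empty never = refinement-empty λ _ (q , v-p) → never q v-p

    minAt↔ : (Q′ : (Fin N → Fin N) → Set) → (∀ {w} → Q w → Injective _≡_ _≡_ w) →
             (∀ u → Q (lookup (insertMin p u)) ⇔ Q′ (lookup u)) →
             MinAt p ↔ [ u ∈ Vec (Fin N) N ∣ Q′ (lookup u) ]
    minAt↔ Q′ Q⇒injective Q⇔Q′ =
      mk↔ₛ′ remove insert (value-injective ∘ removeMin-insertMin p ∘ value) insert-remove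
      where
      restore : ∀ {v} → .(Q (lookup v)) → .(lookup v p ≡ fzero) → insertMin p (removeMin p v) ≡ v
      restore {v} q v-p = recompute (≡-dec _≟_ _ _) (insertMin-removeMin p v v-p (Q⇒injective q))

      remove : MinAt p → [ u ∈ Vec (Fin N) N ∣ Q′ (lookup u) ]
      remove (v , [ q,v-p ]) = removeMin p v ,
        [ Equivalence.to (Q⇔Q′ _) (subst (Q ∘ lookup) (sym (restore {v} (proj₁ q,v-p) (proj₂ q,v-p)))
                                         (proj₁ q,v-p)) ]

      insert : [ u ∈ Vec (Fin N) N ∣ Q′ (lookup u) ] → MinAt p
      insert (u , [ q′ ]) = insertMin p u , [ Equivalence.from (Q⇔Q′ u) q′ , lookup-insertMin-p p u ]

      insert-remove : ∀ x → insert (remove x) ≡ x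
      insert-remove (v , [ q,v-p ]) = value-injective (restore {v} (proj₁ q,v-p) (proj₂ q,v-p))

countKL↓ : ℕ → ℕ → ℕ
countKL↓ zero zero = 1
countKL↓ zero (suc _) = 0
countKL↓ (suc r) n = (n ∸ 1) C r

countKL↓-pascal : ∀ {r M} → r < M → countKL↓ (suc r) (suc M) ≡ countKL↓ r M + countKL↓ (suc r) M
countKL↓-pascal {zero} {suc M} _ = refl
countKL↓-pascal {suc r} {suc M} _ = sym (nCk+nC[k+1]≡[n+1]C[k+1] M r)

countKL↓-diagonal : ∀ M → countKL↓ (suc M) (suc M) ≡ countKL↓ M M
countKL↓-diagonal zero = refl
countKL↓-diagonal (suc M) = trans (nCn≡1 (suc M)) (sym (nCn≡1 M))

[1+m]P′[1+k]≡[1+m]*mP′k : ∀ m k → suc m P′ suc k ≡ suc m * (m P′ k)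
[1+m]P′[1+k]≡[1+m]*mP′k m zero = refl
[1+m]P′[1+k]≡[1+m]*mP′k m (suc k) =
  trans (cong ((m ∸ k) *_) ([1+m]P′[1+k]≡[1+m]*mP′k m k)) (x∙yz≈y∙xz (m ∸ k) (suc m) (m P′ k))

[1+m]P[1+k]≡[1+m]*mPk : ∀ m k → suc m P suc k ≡ suc m * (m P k)
[1+m]P[1+k]≡[1+m]*mPk m zero = refl
[1+m]P[1+k]≡[1+m]*mPk m (suc k) with k <ᵇ m
... | true = [1+m]P′[1+k]≡[1+m]*mP′k m (suc k)
... | false = sym (*-zeroʳ (suc m))

sumˡ-map-scaled : {A : Set} {f g : A → ℕ} (c : ℕ) → (∀ x → f x ≡ c * g x) →
                  ∀ xs → sumˡ (List.map f xs) ≡ c * sumˡ (List.map g xs)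
sumˡ-map-scaled c f≡c*g [] = sym (*-zeroʳ c)
sumˡ-map-scaled {g = g} c f≡c*g (x ∷ xs) =
  trans (cong₂ _+_ (f≡c*g x) (sumˡ-map-scaled c f≡c*g xs)) (sym (*-distribˡ-+ c (g x) _))

rhs-summand : ℕ → ℕ → ℕ → ℕ
rhs-summand r n j = ((n ∸ suc j ∸ 1) C (r ∸ suc j)) * (r P j)

rhs-suc : ∀ r M → rhs (suc r) (suc M) ≡ suc r * rhs r M + countKL↓ (suc r) M
rhs-suc r M = begin
  rhs (suc r) (suc M)                                           ≡⟨⟩
  ((M ∸ 1) C r) * 1 + sumˡ (List.map summand (applyUpTo suc r)) ≡⟨ cong₂ _+_ (*-identityʳ _) shift ⟩
  (M ∸ 1) C r + sumˡ (List.map (summand ∘ suc) (upTo r))        ≡⟨ cong ((M ∸ 1) C r +_) scale ⟩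
  (M ∸ 1) C r + suc r * rhs r M                                 ≡⟨ +-comm ((M ∸ 1) C r) _ ⟩
  suc r * rhs r M + countKL↓ (suc r) M                          ∎
  where
  open ≡-Reasoning
  summand : ℕ → ℕ
  summand = rhs-summand (suc r) (suc M)

  shift : sumˡ (List.map summand (applyUpTo suc r)) ≡ sumˡ (List.map (summand ∘ suc) (upTo r))
  shift = cong sumˡ (trans (map-applyUpTo suc summand r) (sym (map-applyUpTo id (summand ∘ suc) r)))

  scale : sumˡ (List.map (summand ∘ suc) (upTo r)) ≡ suc r * rhs r M
  scale = sumˡ-map-scaled (suc r) (λ j →
    trans (cong (((M ∸ suc j ∸ 1) C (r ∸ suc j)) *_) ([1+m]P[1+k]≡[1+m]*mPk r j))
          (x∙yz≈y∙xz ((M ∸ suc j ∸ 1) C (r ∸ suc j)) (suc r) (r P j))) (upTo r)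

KL : ℕ → ℕ → Set
KL r N = [ v ∈ Vec (Fin N) N ∣ InKL r (lookup v) ]

KL↓ : ℕ → ℕ → Set
KL↓ r N = [ v ∈ Vec (Fin N) N ∣ InKL↓ r (lookup v) ]

size-KL↓ : ∀ N r → r ≤ N → KL↓ r N ↔ Fin (countKL↓ r N)
size-KL↓ zero zero _ =
  mk↔ₛ′ (λ _ → fzero) (λ _ → [] , [ inKL↓-empty ])
        (λ { fzero → refl ; (fsuc ()) }) (λ { ([] , _) → refl })
size-KL↓ (suc M) zero _ = ¬⇒↔Fin0 (refinement-empty λ _ (kl , _) → ¬InKL0 kl)
size-KL↓ (suc M) (suc r) r<1+M with m≤n⇒m<n∨m≡n (s≤s⁻¹ r<1+M)
... | inj₁ r<M =
  resize (sym (countKL↓-pascal r<M))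
    (↔-trans (split-by-minimum (InKL↓ (suc r)) InKL↓⇒injective)
             (Σ-Fin-two-point (MinAt (InKL↓ (suc r))) q (subst (_< M) (sym toℕ-q) r<M)
                              elsewhere at-q at-end))
  where
  q : Fin (suc M)
  q = fromℕ< r<1+M

  toℕ-q : toℕ q ≡ r
  toℕ-q = toℕ-fromℕ< r<1+M

  elsewhere : ∀ p → p ≢ q → toℕ p < M → ¬ MinAt (InKL↓ (suc r)) p
  elsewhere p p≢q p<M = minAt-empty (InKL↓ (suc r)) λ (kl , decreasing) w-p →
    case <-cmp (toℕ p) r of λ where
      (tri< p<r _ _) → <⇒≱ p<r (s≤s⁻¹ (decreasing-left-ends-by-minimum w-p decreasing p<M))
      (tri≈ _ p≡r _) → p≢q (toℕ-injective (trans p≡r (sym toℕ-q)))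
      (tri> _ _ r<p) → <⇒≢ p<M (minimum-on-right-is-last w-p kl r<p)

  at-q : MinAt (InKL↓ (suc r)) q ↔ Fin (countKL↓ r M)
  at-q = ↔-trans (minAt↔ (InKL↓ (suc r)) (InKL↓ r) InKL↓⇒injective λ u →
                   Inserted.inKL↓-left q u toℕ-q)
                 (size-KL↓ M r (<⇒≤ r<M))

  at-end : MinAt (InKL↓ (suc r)) (fromℕ M) ↔ Fin (countKL↓ (suc r) M)
  at-end = ↔-trans (minAt↔ (InKL↓ (suc r)) (InKL↓ (suc r)) InKL↓⇒injective λ u →
                     Inserted.inKL↓-last (fromℕ M) u (s≤s z≤n) r<M (toℕ-fromℕ M))
                   (size-KL↓ M (suc r) r<M)
... | inj₂ refl =
  resize (sym (countKL↓-diagonal M))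
    (↔-trans (split-by-minimum (InKL↓ (suc M)) InKL↓⇒injective)
             (Σ-Fin-last (MinAt (InKL↓ (suc M))) before-end at-end))
  where
  before-end : ∀ p → toℕ p < M → ¬ MinAt (InKL↓ (suc M)) p
  before-end p p<M = minAt-empty (InKL↓ (suc M)) λ (_ , decreasing) w-p →
    <⇒≱ p<M (s≤s⁻¹ (decreasing-left-ends-by-minimum w-p decreasing p<M))

  at-end : MinAt (InKL↓ (suc M)) (fromℕ M) ↔ Fin (countKL↓ M M)
  at-end = ↔-trans (minAt↔ (InKL↓ (suc M)) (InKL↓ M) InKL↓⇒injective λ u →
                     Inserted.inKL↓-left (fromℕ M) u (toℕ-fromℕ M))
                   (size-KL↓ M M ≤-refl)

size-KL : ∀ N r → r < N → KL r N ↔ Fin (rhs r N)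
size-KL (suc M) zero _ = ¬⇒↔Fin0 (refinement-empty λ _ kl → ¬InKL0 kl)
size-KL (suc M) (suc r) 1+r<1+M =
  resize (sym (rhs-suc r M))
    (↔-trans (split-by-minimum (InKL (suc r)) InKL.injective)
             (Σ-Fin-profile (MinAt (InKL (suc r))) r<M at-left in-middle at-end))
  where
  r<M : r < M
  r<M = s<s⁻¹ 1+r<1+M

  at-left : ∀ p → toℕ p < suc r → MinAt (InKL (suc r)) p ↔ Fin (rhs r M)
  at-left p p≤r = ↔-trans (minAt↔ (InKL (suc r)) (InKL r) InKL.injective λ u →
                            Inserted.inKL-left p u (s≤s⁻¹ p≤r))
                          (size-KL M r r<M)

  in-middle : ∀ p → suc r ≤ toℕ p → toℕ p < M → ¬ MinAt (InKL (suc r)) p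
  in-middle p r<p p<M =
    minAt-empty (InKL (suc r)) λ kl w-p → <⇒≢ p<M (minimum-on-right-is-last w-p kl r<p)

  at-end : MinAt (InKL (suc r)) (fromℕ M) ↔ Fin (countKL↓ (suc r) M)
  at-end = ↔-trans (minAt↔ (InKL (suc r)) (InKL↓ (suc r)) InKL.injective λ u →
                     Inserted.inKL-last (fromℕ M) u (s≤s z≤n) r<M (toℕ-fromℕ M))
                   (size-KL↓ M (suc r) r<M)

-- The identity also holds for r = 0 (both sides vanish).
proposition2p3 : (r n : ℕ) → 1 ≤ r → r < n → cardKL r n ≡ rhs r n
proposition2p3 r (suc N) _ r<n = size-unique
  (count-allFuns (suc N) (inKL r) (inKL-respects-≗ r))
  (↔-trans (refinement-cong T-inKL) (size-KL (suc N) r r<n))
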